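{- Let $\mathbb{D}$ be a small category and $\mathsf{K}$ a small $\mathsf{DCpo}^\vee$-enriched category admitting coproducts of all families indexed by objects of $\mathbb{D}$, with cotupling of such families preserving the order. Then the category $\widehat{\mathsf{K}}$ admits coproducts of all families indexed by objects of $\mathbb{D}$, with cotupling preserving the order.
   Context: $\mathsf{DCpo}^\vee$-enriched: hom-sets are posets with directed suprema and binary joins, composition monotone and preserving directed suprema in each variable. Cotupling preserves order: if $f_i\leq g_i:X_i\to Y$ for all $i$ then $[f_i]\leq[g_i]$. $\mathsf{DCpo}^\vee$ is the category of such posets with Scott-continuous maps, pointwise ordered. $\widetilde{\mathsf{K}}$ is the category of lax functors $\mathsf{K}\to\mathsf{DCpo}^\vee$ ($id\leq\pi(id)$, $\pi(g)\circ\pi(h)\leq\pi(g\circ h)$) with oplax transformations ($f_{X'}\circ\pi(g)\leq\pi'(g)\circ f_X$), ordered pointwise. $\widehat{X}=\mathsf{K}(X,-)$, and for $f:X\to X'$, $\widehat{f}=\mathsf{K}(f,-):\widehat{X'}\to\widehat{X}$ ($h\mapsto h\circ f$). $\widehat{\mathsf{K}}$ is the full subcategory of $\widetilde{\mathsf{K}}^{op}$ on the objects $\widehat{X}$, $X\in\mathsf{K}$, with order inherited from $\widetilde{\mathsf{K}}$. -}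

module Defs where

open import Data.Product using (Σ; _×_; _,_; proj₁; proj₂)
open import Relation.Binary.PropositionalEquality using (_≡_; refl; sym)
open import Relation.Binary.Structures using (IsPartialOrder)

module _ {A : Set} (_≤_ : A → A → Set) where

  Directed : {I : Set} → (I → A) → Set
  Directed {I} d = I × ((i j : I) → Σ I (λ k → (d i ≤ d k) × (d j ≤ d k)))

  IsLub : {I : Set} → (I → A) → A → Set
  IsLub {I} d s = ((i : I) → d i ≤ s) × ((u : A) → ((i : I) → d i ≤ u) → s ≤ u)

  IsJoin : A → A → A → Set
  IsJoin x y s = (x ≤ s) × (y ≤ s) × ((u : A) → x ≤ u → y ≤ u → s ≤ u)

record DCpoJ : Set₁ where
  field
    Carrier        : Set
    _≤_            : Carrier → Carrier → Set
    isPartialOrder : IsPartialOrder _≡_ _≤_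
    dsup           : {I : Set} (d : I → Carrier) → Directed _≤_ d → Σ Carrier (IsLub _≤_ d)
    join           : (x y : Carrier) → Σ Carrier (IsJoin _≤_ x y)
  open IsPartialOrder isPartialOrder public
    using (reflexive; trans; antisym) renaming (refl to ≤-refl)

open DCpoJ using (Carrier)

record ScottMap (P Q : DCpoJ) : Set₁ where
  private
    module P = DCpoJ P
    module Q = DCpoJ Q
  field
    fun  : Carrier P → Carrier Q
    mono : ∀ {x y} → x P.≤ y → fun x Q.≤ fun y
    cont : ∀ {I : Set} (d : I → Carrier P) → Directed P._≤_ d →
           ∀ s → IsLub P._≤_ d s → IsLub Q._≤_ (λ i → fun (d i)) (fun s)
open ScottMap using (fun)

idScott : (P : DCpoJ) → ScottMap P P
idScott P = record { fun = λ x → x ; mono = λ p → p ; cont = λ d _ s l → l }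

_∘S_ : {P Q R : DCpoJ} → ScottMap Q R → ScottMap P Q → ScottMap P R
_∘S_ {P} {Q} {R} g f = record
  { fun  = λ x → fun g (fun f x)
  ; mono = λ p → ScottMap.mono g (ScottMap.mono f p)
  ; cont = λ d dd s l →
      ScottMap.cont g (λ i → fun f (d i))
        ( proj₁ dd
        , λ i j → let (k , a , b) = proj₂ dd i j
                  in k , ScottMap.mono f a , ScottMap.mono f b)
        (fun f s) (ScottMap.cont f d dd s l) }

record SmallCat : Set₁ where
  field
    Ob    : Set
    Hom   : Ob → Ob → Set
    id    : ∀ {X} → Hom X X
    _∘_   : ∀ {X Y Z} → Hom Y Z → Hom X Y → Hom X Z
    assoc : ∀ {W X Y Z} (h : Hom Y Z) (g : Hom X Y) (f : Hom W X) →
            (h ∘ g) ∘ f ≡ h ∘ (g ∘ f)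
    idˡ   : ∀ {X Y} (f : Hom X Y) → id ∘ f ≡ f
    idʳ   : ∀ {X Y} (f : Hom X Y) → f ∘ id ≡ f

record DEnrCat : Set₁ where
  field
    Ob   : Set
    HomP : Ob → Ob → DCpoJ

  Hom : Ob → Ob → Set
  Hom X Y = Carrier (HomP X Y)

  _≤_ : ∀ {X Y} → Hom X Y → Hom X Y → Set
  _≤_ {X} {Y} = DCpoJ._≤_ (HomP X Y)

  field
    id    : ∀ {X} → Hom X X
    _∘_   : ∀ {X Y Z} → Hom Y Z → Hom X Y → Hom X Z
    assoc : ∀ {W X Y Z} (h : Hom Y Z) (g : Hom X Y) (f : Hom W X) →
            (h ∘ g) ∘ f ≡ h ∘ (g ∘ f)
    idˡ   : ∀ {X Y} (f : Hom X Y) → id ∘ f ≡ f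
    idʳ   : ∀ {X Y} (f : Hom X Y) → f ∘ id ≡ f
    ∘-monoˡ : ∀ {X Y Z} {f f' : Hom Y Z} (g : Hom X Y) → f ≤ f' → (f ∘ g) ≤ (f' ∘ g)
    ∘-monoʳ : ∀ {X Y Z} (f : Hom Y Z) {g g' : Hom X Y} → g ≤ g' → (f ∘ g) ≤ (f ∘ g')
    ∘-contˡ : ∀ {X Y Z} {I : Set} (d : I → Hom Y Z) → Directed _≤_ d →
              ∀ s → IsLub _≤_ d s → (g : Hom X Y) →
              IsLub _≤_ (λ i → d i ∘ g) (s ∘ g)
    ∘-contʳ : ∀ {X Y Z} (f : Hom Y Z) {I : Set} (d : I → Hom X Y) → Directed _≤_ d →
              ∀ s → IsLub _≤_ d s →
              IsLub _≤_ (λ i → f ∘ d i) (f ∘ s)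

-- Lax functors K → DCpo^∨ and oplax transformations (the category K̃)

module _ (K : DEnrCat) where
  open DEnrCat K

  record LaxFunctor : Set₁ where
    field
      obj    : Ob → DCpoJ
      map    : ∀ {X Y} → Hom X Y → ScottMap (obj X) (obj Y)
      lax-id : ∀ {X} (x : Carrier (obj X)) → DCpoJ._≤_ (obj X) x (fun (map (id {X})) x)
      lax-∘  : ∀ {X Y Z} (g : Hom Y Z) (h : Hom X Y) (x : Carrier (obj X)) →
               DCpoJ._≤_ (obj Z) (fun (map g) (fun (map h) x)) (fun (map (g ∘ h)) x)

  open LaxFunctor

  record Oplax (π π' : LaxFunctor) : Set₁ where
    field
      comp  : ∀ X → ScottMap (obj π X) (obj π' X)
      oplax : ∀ {X X'} (g : Hom X X') (x : Carrier (obj π X)) →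
              DCpoJ._≤_ (obj π' X') (fun (comp X') (fun (map π g) x))
                                    (fun (map π' g) (fun (comp X) x))
  open Oplax

  _≤Ox_ : {π π' : LaxFunctor} → Oplax π π' → Oplax π π' → Set
  _≤Ox_ {π} {π'} f g = ∀ X (x : Carrier (obj π X)) →
                       DCpoJ._≤_ (obj π' X) (fun (comp f X) x) (fun (comp g X) x)

  _≈Ox_ : {π π' : LaxFunctor} → Oplax π π' → Oplax π π' → Set
  _≈Ox_ {π} {π'} f g = ∀ X (x : Carrier (obj π X)) → fun (comp f X) x ≡ fun (comp g X) x

  _∘Ox_ : {π π' π'' : LaxFunctor} → Oplax π' π'' → Oplax π π' → Oplax π π''
  _∘Ox_ {π} {π'} {π''} f g = record
    { comp  = λ X → comp f X ∘S comp g X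
    ; oplax = λ {X} {X'} h x →
        DCpoJ.trans (obj π'' X')
          (ScottMap.mono (comp f X') (oplax g h x))
          (oplax f h (fun (comp g X) x)) }

  rep : Ob → LaxFunctor
  rep X = record
    { obj    = λ Z → HomP X Z
    ; map    = λ {Z} {Z'} g → record
        { fun  = λ h → g ∘ h
        ; mono = ∘-monoʳ g
        ; cont = ∘-contʳ g }
    ; lax-id = λ {Z} h → DCpoJ.reflexive (HomP X Z) (sym (idˡ h))
    ; lax-∘  = λ {Z} {Z'} {Z''} g h x → DCpoJ.reflexive (HomP X Z'') (sym (assoc g h x)) }

record CatStr : Set₂ where
  field
    Ob  : Set
    Hom : Ob → Ob → Set₁
    _≈_ : ∀ {X Y} → Hom X Y → Hom X Y → Set
    _≤_ : ∀ {X Y} → Hom X Y → Hom X Y → Set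
    _∘_ : ∀ {X Y Z} → Hom Y Z → Hom X Y → Hom X Z

record OrdCoproduct (C : CatStr) {I : Set} (X : I → CatStr.Ob C) : Set₁ where
  open CatStr C
  field
    obj      : Ob
    inj      : (i : I) → Hom (X i) obj
    cotuple  : ∀ {Y} → ((i : I) → Hom (X i) Y) → Hom obj Y
    commute  : ∀ {Y} (f : (i : I) → Hom (X i) Y) (i : I) → (cotuple f ∘ inj i) ≈ f i
    unique   : ∀ {Y} (f : (i : I) → Hom (X i) Y) (g : Hom obj Y) →
               ((i : I) → (g ∘ inj i) ≈ f i) → g ≈ cotuple f
    cotuple-mono : ∀ {Y} (f g : (i : I) → Hom (X i) Y) →
                   ((i : I) → f i ≤ g i) → cotuple f ≤ cotuple g

HasOrdCoproducts : (I : Set) → CatStr → Set₁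
HasOrdCoproducts I C = (X : I → CatStr.Ob C) → OrdCoproduct C X

open import Level using (Lift; lift)

-- K viewed as a CatStr (homs lifted to Set₁ for uniformity; equality is ≡)
underlying : DEnrCat → CatStr
underlying K = record
  { Ob  = DEnrCat.Ob K
  ; Hom = λ X Y → Lift _ (DEnrCat.Hom K X Y)
  ; _≈_ = λ f g → Level.lower f ≡ Level.lower g
  ; _≤_ = λ f g → DEnrCat._≤_ K (Level.lower f) (Level.lower g)
  ; _∘_ = λ f g → lift (DEnrCat._∘_ K (Level.lower f) (Level.lower g)) }

-- K̂: full subcategory of K̃^op on the representables X̂.
-- A morphism X̂ → X̂' in K̂ is a morphism X̂' → X̂ in K̃, i.e. an oplax
-- transformation K(X',-) ⇒ K(X,-); order and equality are pointwise.
KHat : DEnrCat → CatStr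
KHat K = record
  { Ob  = DEnrCat.Ob K
  ; Hom = λ X X' → Oplax K (rep K X') (rep K X)
  ; _≈_ = _≈Ox_ K
  ; _≤_ = _≤Ox_ K
  ; _∘_ = λ g f → _∘Ox_ K f g }

module Submission where

-- Coproducts in K̂ are computed as in K.  Let S = ∐ Xᵢ be a coproduct in K
-- with injections ιᵢ.  The K̂-injection X̂ᵢ → Ŝ is the oplax transformation
-- K(S,-) ⇒ K(Xᵢ,-), h ↦ h ∘ ιᵢ (precomposition, which is even strict), and
-- the cotuple of a family fᵢ : K(Y,-) ⇒ K(Xᵢ,-) is the transformation
-- h ↦ [ fᵢ,Z(h) ]ᵢ.  These make
-- the cotuple a Scott-continuous, oplax transformation; the coproduct
-- equations and order preservation in K̂ are then checked componentwise,
-- where they are exactly the corresponding properties in K.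

open import Defs
open import Data.Product using (_,_; proj₁; proj₂)
open import Relation.Binary.PropositionalEquality using (_≡_; refl; sym; trans; cong)
open import Level using (lift; lower)
open ScottMap using (fun)

module _ (K : DEnrCat) where
  open DEnrCat K

  private
    ≤-reflexive : ∀ {A B} {x y : Hom A B} → x ≡ y → x ≤ y
    ≤-reflexive {A} {B} = DCpoJ.reflexive (HomP A B)

    ≤-trans : ∀ {A B} {x y z : Hom A B} → x ≤ y → y ≤ z → x ≤ z
    ≤-trans {A} {B} = DCpoJ.trans (HomP A B)

  -- Precomposition with u : X → Y is a (strict) transformation
  -- K(Y,-) ⇒ K(X,-): the action of the Yoneda embedding on morphisms.
  precompose : ∀ {X Y} → Hom X Y → Oplax K (rep K Y) (rep K X)
  precompose u = record
    { comp  = λ Z → record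
        { fun  = λ h → h ∘ u
        ; mono = ∘-monoˡ u
        ; cont = λ d dd s l → ∘-contˡ d dd s l u }
    ; oplax = λ g h → ≤-reflexive (assoc g h u) }

  module InK {I : Set} {Xs : I → Ob} (C : OrdCoproduct (underlying K) Xs) where
    private module C = OrdCoproduct C

    S : Ob
    S = C.obj

    ι : (i : I) → Hom (Xs i) S
    ι i = lower (C.inj i)

    [_] : ∀ {Y} → ((i : I) → Hom (Xs i) Y) → Hom S Y
    [ f ] = lower (C.cotuple (λ i → lift (f i)))

    [-]-commute : ∀ {Y} (f : (i : I) → Hom (Xs i) Y) (i : I) → [ f ] ∘ ι i ≡ f i
    [-]-commute f = C.commute (λ i → lift (f i))

    [-]-unique : ∀ {Y} (f : (i : I) → Hom (Xs i) Y) (g : Hom S Y) →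
                 ((i : I) → g ∘ ι i ≡ f i) → g ≡ [ f ]
    [-]-unique f g = C.unique (λ i → lift (f i)) (lift g)

    [-]-mono : ∀ {Y} {f g : (i : I) → Hom (Xs i) Y} →
               ((i : I) → f i ≤ g i) → [ f ] ≤ [ g ]
    [-]-mono {f = f} {g} = C.cotuple-mono (λ i → lift (f i)) (λ i → lift (g i))

    [-]-η : ∀ {Y} (u : Hom S Y) → u ≡ [ (λ i → u ∘ ι i) ]
    [-]-η u = [-]-unique _ u (λ i → refl)

    [-]-natural : ∀ {Y Y'} (g : Hom Y Y') (f : (i : I) → Hom (Xs i) Y) →
                  g ∘ [ f ] ≡ [ (λ i → g ∘ f i) ]
    [-]-natural g f = [-]-unique _ (g ∘ [ f ]) λ i →
      trans (assoc g [ f ] (ι i)) (cong (g ∘_) ([-]-commute f i))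

    -- An upper bound u of the [ eⱼ ] restricts to upper bounds u ∘ ιᵢ.
    [-]-lub : ∀ {Y} {J : Set} (e : J → (i : I) → Hom (Xs i) Y)
              (t : (i : I) → Hom (Xs i) Y) →
              ((i : I) → IsLub _≤_ (λ j → e j i) (t i)) →
              IsLub _≤_ (λ j → [ e j ]) [ t ]
    [-]-lub e t lub = upper , least
      where
        upper : ∀ j → [ e j ] ≤ [ t ]
        upper j = [-]-mono (λ i → proj₁ (lub i) j)

        least : ∀ u → (∀ j → [ e j ] ≤ u) → [ t ] ≤ u
        least u bound = ≤-trans ([-]-mono tᵢ≤uιᵢ) (≤-reflexive (sym ([-]-η u)))
          where
            tᵢ≤uιᵢ : ∀ i → t i ≤ (u ∘ ι i)
            tᵢ≤uιᵢ i = proj₂ (lub i) (u ∘ ι i) λ j →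
              ≤-trans (≤-reflexive (sym ([-]-commute (e j) i))) (∘-monoˡ (ι i) (bound j))

  module InKHat {I : Set} {Xs : I → Ob} (C : OrdCoproduct (underlying K) Xs) where
    open InK C

    module _ {Y : Ob} (f : (i : I) → Oplax K (rep K Y) (rep K (Xs i))) where
      components : (Z : Ob) → Hom Y Z → (i : I) → Hom (Xs i) Z
      components Z h i = fun (Oplax.comp (f i) Z) h

      cotuple-at : (Z : Ob) → ScottMap (HomP Y Z) (HomP S Z)
      cotuple-at Z = record
        { fun  = λ h → [ components Z h ]
        ; mono = λ p → [-]-mono (λ i → ScottMap.mono (Oplax.comp (f i) Z) p)
        ; cont = λ d dd s l → [-]-lub (λ j → components Z (d j)) (components Z s)
                   (λ i → ScottMap.cont (Oplax.comp (f i) Z) d dd s l) }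

      -- oplaxness: [ fᵢ(g ∘ h) ] ≤ [ g ∘ fᵢ(h) ] = g ∘ [ fᵢ(h) ]
      cotuple : Oplax K (rep K Y) (rep K S)
      cotuple = record
        { comp  = cotuple-at
        ; oplax = λ {Z} g h →
            ≤-trans ([-]-mono (λ i → Oplax.oplax (f i) g h))
                    (≤-reflexive (sym ([-]-natural g (components Z h)))) }

    coproduct : OrdCoproduct (KHat K) Xs
    coproduct = record
      { obj          = S
      ; inj          = λ i → precompose (ι i)
      ; cotuple      = cotuple
      ; commute      = λ f i Z h → [-]-commute (components f Z h) i
      ; unique       = λ f g p Z h →
          [-]-unique (components f Z h) (fun (Oplax.comp g Z) h) (λ i → p i Z h)
      ; cotuple-mono = λ f g p Z h → [-]-mono (λ i → p i Z h) }

theorem4p3 : (D : SmallCat) (K : DEnrCat) →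
    HasOrdCoproducts (SmallCat.Ob D) (underlying K) →
    HasOrdCoproducts (SmallCat.Ob D) (KHat K)
theorem4p3 D K coproducts Xs = InKHat.coproduct K (coproducts Xs)
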